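{- Let $p$ be a prime with $p \equiv 7$ or $23 \pmod{40}$. Then there is no triple $(N,M,e) \in \mathbb{Z}^3$ with $M \neq 0$, $e \neq 0$ satisfying $N^2 = 5M^4 - pe^4$ together with $\gcd(N,e)=\gcd(M,e)=\gcd(5,e)=\gcd(p,M)=\gcd(M,N)=1$. -}

module Defs where

-- Reduce modulo 5. Since 5 ∤ e, Fermat gives e⁴ ≡ 1, and p ≡ 7 or 23 (mod 40) gives
-- p ≡ 2 or 3 (mod 5); so N² = 5M⁴ − pe⁴ forces N² ≡ −2 or −3, i.e. N² ≡ 3 or 2 (mod 5),
-- and neither is a square mod 5.
module Submission where

open import Defs
open import Data.Nat using (ℕ)
open import Data.Nat.DivMod using (_%_)
open import Data.Nat.Primality using (Prime)
open import Data.Integer using (ℤ; +_; _*_; _-_; _^_; 1ℤ; 0ℤ)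
open import Data.Integer.GCD using (gcd)
open import Data.Product using (Σ; _×_)
open import Data.Sum using (_⊎_)
open import Relation.Nullary using (¬_)
open import Relation.Binary.PropositionalEquality using (_≡_; _≢_)

open import Function using (_∘_)
open import Data.Fin using (Fin; toℕ; fromℕ<)
open import Data.Fin.Properties using (toℕ-fromℕ<; all?)
open import Data.Integer using (_+_; -_; ∣_∣; NonZero)
import Data.Integer.DivMod as ℤ
open import Data.Integer.Divisibility.Signed
  using (_∣_; divides; _∣?_; ∣-trans; ∣⇒∣ᵤ; ∣m⇒∣-m; ∣m∣n⇒∣m+n; ∣m⇒∣m*n; ∣n⇒∣m*n)
open import Data.Integer.GCD using (gcd-greatest)
open import Data.Integer.Properties using (+-identityʳ)
open import Data.Integer.Tactic.RingSolver using (solve-∀)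
import Data.Nat as ℕ
import Data.Nat.Divisibility as ℕ
open import Data.Product using (_,_; proj₁; proj₂)
import Data.Sum as Sum
open import Relation.Binary.PropositionalEquality using (refl; sym; cong; subst; module ≡-Reasoning)
open import Relation.Nullary.Decidable using (Dec; map′; from-yes; ¬?; _→-dec_; _×-dec_)

infix 4 _≡_mod_

record _≡_mod_ (x y n : ℤ) : Set where
  constructor ≡-mod
  field divides-difference : n ∣ x - y

module _ {n : ℤ} where

  ≡-mod-refl : ∀ {x} → x ≡ x mod n
  ≡-mod-refl {x} = ≡-mod (divides 0ℤ (lemma x))
    where
    lemma : ∀ x → x - x ≡ 0ℤ * n
    lemma = solve-∀

  ≡-mod-sym : ∀ {x y} → x ≡ y mod n → y ≡ x mod n
  ≡-mod-sym {x} {y} (≡-mod n∣x-y) = ≡-mod (subst (n ∣_) (lemma x y) (∣m⇒∣-m n∣x-y))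
    where
    lemma : ∀ x y → - (x - y) ≡ y - x
    lemma = solve-∀

  ≡-mod-trans : ∀ {x y z} → x ≡ y mod n → y ≡ z mod n → x ≡ z mod n
  ≡-mod-trans {x} {y} {z} (≡-mod n∣x-y) (≡-mod n∣y-z) =
    ≡-mod (subst (n ∣_) (lemma x y z) (∣m∣n⇒∣m+n n∣x-y n∣y-z))
    where
    lemma : ∀ x y z → (x - y) + (y - z) ≡ x - z
    lemma = solve-∀

  +-cong-mod : ∀ {x y u v} → x ≡ y mod n → u ≡ v mod n → x + u ≡ y + v mod n
  +-cong-mod {x} {y} {u} {v} (≡-mod n∣x-y) (≡-mod n∣u-v) =
    ≡-mod (subst (n ∣_) (lemma x y u v) (∣m∣n⇒∣m+n n∣x-y n∣u-v))
    where
    lemma : ∀ x y u v → (x - y) + (u - v) ≡ (x + u) - (y + v)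
    lemma = solve-∀

  *-cong-mod : ∀ {x y u v} → x ≡ y mod n → u ≡ v mod n → x * u ≡ y * v mod n
  *-cong-mod {x} {y} {u} {v} (≡-mod n∣x-y) (≡-mod n∣u-v) =
    ≡-mod (subst (n ∣_) (lemma x y u v) (∣m∣n⇒∣m+n (∣m⇒∣m*n u n∣x-y) (∣n⇒∣m*n y n∣u-v)))
    where
    lemma : ∀ x y u v → (x - y) * u + y * (u - v) ≡ x * u - y * v
    lemma = solve-∀

  ^-cong-mod : ∀ {x y} k → x ≡ y mod n → x ^ k ≡ y ^ k mod n
  ^-cong-mod ℕ.zero    _   = ≡-mod-refl
  ^-cong-mod (ℕ.suc k) x≡y = *-cong-mod x≡y (^-cong-mod k x≡y)

≡-mod? : ∀ x y n → Dec (x ≡ y mod n)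
≡-mod? x y n = map′ ≡-mod _≡_mod_.divides-difference (n ∣? x - y)

≡-mod-divisor : ∀ {m n x y} → m ∣ n → x ≡ y mod n → x ≡ y mod m
≡-mod-divisor m∣n (≡-mod n∣x-y) = ≡-mod (∣-trans m∣n n∣x-y)

≡0-mod⇒∣ : ∀ {n x} → x ≡ 0ℤ mod n → n ∣ x
≡0-mod⇒∣ {n} {x} (≡-mod n∣x-0) = subst (n ∣_) (+-identityʳ x) n∣x-0

a≡a%n-mod-n : ∀ a n .{{_ : NonZero n}} → a ≡ + (a ℤ.% n) mod n
a≡a%n-mod-n a n = ≡-mod (divides (a ℤ./ n) (begin
  a - + r                   ≡⟨ cong (_- + r) (ℤ.a≡a%n+[a/n]*n a n) ⟩
  + r + (a ℤ./ n) * n - + r ≡⟨ lemma (+ r) (a ℤ./ n) n ⟩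
  (a ℤ./ n) * n             ∎))
  where
  open ≡-Reasoning
  r = a ℤ.% n
  lemma : ∀ r q n → r + q * n - r ≡ q * n
  lemma = solve-∀

residue : (a n : ℤ) .{{_ : NonZero n}} → Fin ∣ n ∣
residue a n = fromℕ< (ℤ.n%d<d a n)

a≡residue-mod-n : ∀ a n .{{_ : NonZero n}} → a ≡ + toℕ (residue a n) mod n
a≡residue-mod-n a n = subst (λ r → a ≡ + r mod n) (sym (toℕ-fromℕ< (ℤ.n%d<d a n))) (a≡a%n-mod-n a n)

residue≡0⇒∣ : ∀ a n .{{_ : NonZero n}} → toℕ (residue a n) ≡ 0 → n ∣ a
residue≡0⇒∣ a n r≡0 = ≡0-mod⇒∣ (subst (λ r → a ≡ + r mod n) r≡0 (a≡residue-mod-n a n))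

gcd≡1∧∣⇒∣∣≡1 : ∀ {k i} → gcd k i ≡ 1ℤ → k ∣ i → ∣ k ∣ ≡ 1
gcd≡1∧∣⇒∣∣≡1 {k} {i} gcd≡1 k∣i =
  ℕ.∣1⇒≡1 (subst (λ g → ∣ k ∣ ℕ.∣ ∣ g ∣) gcd≡1 (gcd-greatest {k} {i} {k} ℕ.∣-refl (∣⇒∣ᵤ k∣i)))

x²+2y⁴≢0∧x²+3y⁴≢0-mod-5 : ∀ (x y : Fin 5) → toℕ y ≢ 0 →
  ¬ (+ toℕ x) ^ 2 + + 2 * (+ toℕ y) ^ 4 ≡ 0ℤ mod + 5 × ¬ (+ toℕ x) ^ 2 + + 3 * (+ toℕ y) ^ 4 ≡ 0ℤ mod + 5
x²+2y⁴≢0∧x²+3y⁴≢0-mod-5 = from-yes (all? λ x → all? λ y →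
  ¬? (toℕ y ℕ.≟ 0) →-dec ¬? (x²+cy⁴≡0? 2 x y) ×-dec ¬? (x²+cy⁴≡0? 3 x y))
  where
  x²+cy⁴≡0? : ∀ c (x y : Fin 5) → Dec ((+ toℕ x) ^ 2 + + c * (+ toℕ y) ^ 4 ≡ 0ℤ mod + 5)
  x²+cy⁴≡0? c x y = ≡-mod? _ _ _

x²+cy⁴≢0-mod-5 : ∀ {c} x y → c ≡ + 2 mod + 5 ⊎ c ≡ + 3 mod + 5 → ¬ + 5 ∣ y →
  ¬ x ^ 2 + c * y ^ 4 ≡ 0ℤ mod + 5
x²+cy⁴≢0-mod-5 {c} x y c≡2∨3 5∤y x²+cy⁴≡0 =
  Sum.[ proj₁ residuesCheck ∘ reduced , proj₂ residuesCheck ∘ reduced ] c≡2∨3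
  where
  r s : Fin 5
  r = residue x (+ 5)
  s = residue y (+ 5)
  residuesCheck : ¬ (+ toℕ r) ^ 2 + + 2 * (+ toℕ s) ^ 4 ≡ 0ℤ mod + 5
                × ¬ (+ toℕ r) ^ 2 + + 3 * (+ toℕ s) ^ 4 ≡ 0ℤ mod + 5
  residuesCheck = x²+2y⁴≢0∧x²+3y⁴≢0-mod-5 r s (5∤y ∘ residue≡0⇒∣ y (+ 5))
  reduced : ∀ {c′} → c ≡ c′ mod + 5 → (+ toℕ r) ^ 2 + c′ * (+ toℕ s) ^ 4 ≡ 0ℤ mod + 5
  reduced c≡c′ = ≡-mod-trans (≡-mod-sym (+-cong-mod
    (^-cong-mod 2 (a≡residue-mod-n x (+ 5)))
    (*-cong-mod c≡c′ (^-cong-mod 4 (a≡residue-mod-n y (+ 5)))))) x²+cy⁴≡0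

p%40≡7∨23⇒p≡2∨3-mod-5 : ∀ p → p % 40 ≡ 7 ⊎ p % 40 ≡ 23 → + p ≡ + 2 mod + 5 ⊎ + p ≡ + 3 mod + 5
p%40≡7∨23⇒p≡2∨3-mod-5 p = Sum.map
  (λ p%40≡7  → reduce p%40≡7  (≡-mod (divides 1ℤ refl)))
  (λ p%40≡23 → reduce p%40≡23 (≡-mod (divides (+ 4) refl)))
  where
  reduce : ∀ {r s} → p % 40 ≡ r → + r ≡ + s mod + 5 → + p ≡ + s mod + 5
  reduce refl = ≡-mod-trans (≡-mod-divisor (divides (+ 8) refl) (a≡a%n-mod-n (+ p) (+ 40)))

lemma3p2 : (p : ℕ) → Prime p → (p % 40 ≡ 7 ⊎ p % 40 ≡ 23) →
    ¬ (Σ ℤ λ N → Σ ℤ λ M → Σ ℤ λ e →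
         M ≢ 0ℤ × e ≢ 0ℤ
         × N ^ 2 ≡ (+ 5) * M ^ 4 - (+ p) * e ^ 4
         × gcd N e ≡ 1ℤ × gcd M e ≡ 1ℤ × gcd (+ 5) e ≡ 1ℤ
         × gcd (+ p) M ≡ 1ℤ × gcd M N ≡ 1ℤ)
lemma3p2 p _ p%40≡7∨23 (N , M , e , _ , _ , N²≡5M⁴-pe⁴ , _ , _ , gcd[5,e]≡1 , _ , _) =
  x²+cy⁴≢0-mod-5 N e (p%40≡7∨23⇒p≡2∨3-mod-5 p p%40≡7∨23) 5∤e N²+pe⁴≡0
  where
  5∤e : ¬ + 5 ∣ e
  5∤e 5∣e with () ← gcd≡1∧∣⇒∣∣≡1 gcd[5,e]≡1 5∣e
  N²+pe⁴≡0 : N ^ 2 + + p * e ^ 4 ≡ 0ℤ mod + 5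
  N²+pe⁴≡0 = ≡-mod (divides (M ^ 4) (begin
    N ^ 2 + + p * e ^ 4 - 0ℤ                     ≡⟨ cong (λ a → a + + p * e ^ 4 - 0ℤ) N²≡5M⁴-pe⁴ ⟩
    + 5 * M ^ 4 - + p * e ^ 4 + + p * e ^ 4 - 0ℤ ≡⟨ lemma (M ^ 4) (+ p * e ^ 4) ⟩
    M ^ 4 * + 5                                  ∎))
    where
    open ≡-Reasoning
    lemma : ∀ m q → + 5 * m - q + q - 0ℤ ≡ m * + 5
    lemma = solve-∀
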